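{- Let $G$ be a COM and let $G'$ be an isometric subgraph of $G$ such that every antipodal subgraph of $G'$ is an antipodal subgraph of $G$. Then $G'$ is a COM.
   Context: A partial cube is a finite graph isometrically embedded in a hypercube $Q_n$. Here $Q_n$ has vertex set $\{+,-\}^n$, with adjacency meaning the vectors differ in one coordinate. Notions used: - A subgraph $H$ of a graph $G$ is convex if it contains every shortest path of $G$ between two vertices of $H$. - $H$ is gated if for every vertex $x$ of $G$ there is $v_x\in H$ such that, for every $u\in H$, some shortest $x$–$u$ path passes through $v_x$. - A partial cube is antipodal if, in an isometric embedding into a hypercube of minimal dimension, it contains, with each vertex, the vertex with all coordinates flipped. - An antipodal subgraph of $G$ is a convex subgraph of $G$ that is itself an antipodal partial cube. - A COM is a partial cube all of whose antipodal subgraphs are gated. -}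

module Defs where

open import Data.Nat using (ℕ; zero; suc; _+_; _≤_)
open import Data.Fin using (Fin)
open import Data.Bool using (Bool; true; false; not; if_then_else_)
open import Data.Vec using (Vec; []; _∷_; map)
open import Data.List using (List; []; _∷_)
open import Data.List.Relation.Unary.All using (All)
open import Data.List.Membership.Propositional using (_∈_)
open import Data.Product using (Σ; ∃; _×_; _,_)
open import Data.Unit using (⊤)
open import Relation.Nullary using (¬_)
open import Relation.Binary.PropositionalEquality using (_≡_)

record Graph : Set₁ where
  field
    n       : ℕ
    Adj     : Fin n → Fin n → Set
    Adj-sym : ∀ {u v} → Adj u v → Adj v u
    Adj-irr : ∀ {u} → ¬ Adj u u

module _ (G : Graph) where
  open Graph G

  -- A set of vertices; it stands for the induced subgraph G[S].
  VSet : Set₁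
  VSet = Fin n → Set

  Full : VSet
  Full _ = ⊤

  _⊆_ : VSet → VSet → Set
  T ⊆ S = ∀ v → T v → S v

  data Walk (S : VSet) : Fin n → Fin n → ℕ → Set where
    here : ∀ {u} → S u → Walk S u u zero
    step : ∀ {u w v k} → S u → Adj u w → Walk S w v k → Walk S u v (suc k)

  verts : ∀ {S u v k} → Walk S u v k → List (Fin n)
  verts (here {u} _)       = u ∷ []
  verts (step {u} _ _ p)   = u ∷ verts p

  Dist : VSet → Fin n → Fin n → ℕ → Set
  Dist S u v k = Walk S u v k × (∀ j → Walk S u v j → k ≤ j)

  Geodesic : (S : VSet) {u v : Fin n} {k : ℕ} → Walk S u v k → Set
  Geodesic S {u} {v} {k} _ = ∀ j → Walk S u v j → k ≤ j

  -- Hamming distance on {+,-}^m (encoded as Bool)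
  hamming : ∀ {m} → Vec Bool m → Vec Bool m → ℕ
  hamming []       []       = 0
  hamming (x ∷ xs) (y ∷ ys) = (if x Data.Bool.xor y then 1 else 0) + hamming xs ys

  IsometricEmbedding : VSet → (m : ℕ) → (Fin n → Vec Bool m) → Set
  IsometricEmbedding S m f =
    ∀ u v → S u → S v → Dist S u v (hamming (f u) (f v))

  -- G[S] is a partial cube (graphs are taken nonempty)
  PartialCube : VSet → Set
  PartialCube S = (∃ λ v → S v) × ∃ λ m → ∃ λ f → IsometricEmbedding S m f

  -- G[S] is an antipodal partial cube: in an isometric embedding of minimal
  -- dimension, with each vertex it contains the vertex with all coordinates flipped.
  AntipodalPartialCube : VSet → Set
  AntipodalPartialCube S =
    (∃ λ v → S v) ×
    ∃ λ m → ∃ λ (f : Fin n → Vec Bool m) →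
      IsometricEmbedding S m f ×
      (∀ m' (f' : Fin n → Vec Bool m') → IsometricEmbedding S m' f' → m ≤ m') ×
      (∀ u → S u → ∃ λ w → S w × f w ≡ map not (f u))

  Convex : VSet → VSet → Set
  Convex S T = T ⊆ S ×
    (∀ u v k (p : Walk S u v k) → T u → T v → Geodesic S p → All T (verts p))

  Gated : VSet → VSet → Set
  Gated S T = ∀ x → S x → ∃ λ g → T g ×
    (∀ u → T u → ∃ λ k → Σ (Walk S x u k) λ p → Geodesic S p × g ∈ verts p)

  AntipodalSubgraph : VSet → VSet → Set
  AntipodalSubgraph S T = Convex S T × AntipodalPartialCube T

  IsCOM : VSet → Set₁
  IsCOM S = PartialCube S × (∀ T → AntipodalSubgraph S T → Gated S T)

  IsometricSubgraph : VSet → Set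
  IsometricSubgraph S = (∃ λ v → S v) ×
    (∀ u v → S u → S v → ∀ k → (Dist S u v k → Dist Full u v k) × (Dist Full u v k → Dist S u v k))

-- An isometric subgraph inherits the embedding into the hypercube, so it is a partial cube.
-- An antipodal subgraph T of G' is antipodal in G, hence gated in G with some gate g.
-- For x in G' and u in T, a geodesic of G from x to u through g splits into geodesics
-- x–g and g–u of G; by isometry these are realised inside G', and their concatenation
-- is a walk of G' of length d_G(x,u) = d_{G'}(x,u) through g.
module Submission where

open import Defs
open import Data.Nat using (suc; _+_; _≤_)
open import Data.Nat.Properties using (+-cancelʳ-≤; +-cancelˡ-≤)
open import Data.List.Relation.Unary.Any using (here; there)
open import Data.List.Membership.Propositional using (_∈_)
open import Data.Product using (∃; ∃₂; Σ; _×_; _,_; proj₁; proj₂)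
open import Data.Unit using (tt)
open import Relation.Binary.PropositionalEquality using (_≡_; refl; cong; subst; sym)

module _ (G : Graph) where

  walk-mono : ∀ {S T u v k} → _⊆_ G S T → Walk G S u v k → Walk G T u v k
  walk-mono S⊆T (here su)     = here (S⊆T _ su)
  walk-mono S⊆T (step su a p) = step (S⊆T _ su) a (walk-mono S⊆T p)

  walk-full : ∀ {S u v k} → Walk G S u v k → Walk G (Full G) u v k
  walk-full = walk-mono (λ _ _ → tt)

  _++ʷ_ : ∀ {S x w u a b} → Walk G S x w a → Walk G S w u b → Walk G S x u (a + b)
  here _     ++ʷ r = r
  step s a q ++ʷ r = step s a (q ++ʷ r)

  head-∈-verts : ∀ {S w u b} (r : Walk G S w u b) → w ∈ verts G r
  head-∈-verts (here _)     = here refl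
  head-∈-verts (step _ _ _) = here refl

  join-∈-verts-++ʷ : ∀ {S x w u a b} (q : Walk G S x w a) (r : Walk G S w u b) →
    w ∈ verts G (q ++ʷ r)
  join-∈-verts-++ʷ (here _)     r = head-∈-verts r
  join-∈-verts-++ʷ (step _ _ q) r = there (join-∈-verts-++ʷ q r)

  split-at-∈-verts : ∀ {S x u k g} (p : Walk G S x u k) → g ∈ verts G p →
    ∃₂ λ a b → Walk G S x g a × Walk G S g u b × a + b ≡ k
  split-at-∈-verts (here s)     (here refl) = 0 , 0 , here s , here s , refl
  split-at-∈-verts (step s a p) (here refl) = 0 , _ , here s , step s a p , refl
  split-at-∈-verts (step s a p) (there g∈p) with split-at-∈-verts p g∈p
  ... | a′ , b , q , r , eq = suc a′ , b , step s a q , r , cong suc eq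

  geodesic-split : ∀ {S x u k g} (p : Walk G S x u k) → Geodesic G S p → g ∈ verts G p →
    ∃₂ λ a b → Dist G S x g a × Dist G S g u b × a + b ≡ k
  geodesic-split p geo g∈p with split-at-∈-verts p g∈p
  ... | a , b , q , r , eq = a , b , (q , q-min) , (r , r-min) , eq
    where
    q-min : ∀ j → Walk G _ _ _ j → a ≤ j
    q-min j q′ = +-cancelʳ-≤ b a j (subst (_≤ j + b) (sym eq) (geo _ (q′ ++ʷ r)))
    r-min : ∀ j → Walk G _ _ _ j → b ≤ j
    r-min j r′ = +-cancelˡ-≤ a b j (subst (_≤ a + j) (sym eq) (geo _ (q ++ʷ r′)))

  isometric-partialCube : ∀ {S} → PartialCube G (Full G) → IsometricSubgraph G S →
    PartialCube G S
  isometric-partialCube (_ , m , f , emb) (ne , iso) =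
    ne , m , f , λ u v su sv → proj₂ (iso u v su sv _) (emb u v tt tt)

  isometric-gated : ∀ {S T} → IsometricSubgraph G S → _⊆_ G T S →
    Gated G (Full G) T → Gated G S T
  isometric-gated {S} {T} (_ , iso) T⊆S gated x sx with gated x tt
  ... | g , tg , through-g = g , tg , λ u tu → geodesic-in-S u tu (through-g u tu)
    where
    sg = T⊆S g tg
    geodesic-in-S : ∀ u → T u →
      (∃ λ k → Σ (Walk G (Full G) x u k) λ p → Geodesic G (Full G) p × g ∈ verts G p) →
      ∃ λ k → Σ (Walk G S x u k) λ p → Geodesic G S p × g ∈ verts G p
    geodesic-in-S u tu (k , p , geo , g∈p) with geodesic-split p geo g∈p
    ... | a , b , dxg , dgu , eq =
      a + b , q ++ʷ r , (λ j w → subst (_≤ j) (sym eq) (geo j (walk-full w))) ,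
      join-∈-verts-++ʷ q r
      where
      q = proj₁ (proj₂ (iso x g sx sg a) dxg)
      r = proj₁ (proj₂ (iso g u sg (T⊆S u tu) b) dgu)

lemma15 : (G : Graph) (S' : VSet G) →
    IsCOM G (Full G) →
    IsometricSubgraph G S' →
    (∀ T → AntipodalSubgraph G S' T → AntipodalSubgraph G (Full G) T) →
    IsCOM G S'
lemma15 G S' (pc , gated) iso antipodal-in-G =
  isometric-partialCube G pc iso ,
  λ T antipodal →
    isometric-gated G iso (proj₁ (proj₁ antipodal)) (gated T (antipodal-in-G T antipodal))
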